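{- Let $\Pi X.\,s\,[\exists\vec{x}.\varphi]$ and $\Pi Y.\,t\,[\exists\vec{y}.\psi]$ be existentially constrained terms and $\rho$ a left-linear constrained rewrite rule. If $\Pi X.\,s\,[\exists\vec{x}.\varphi]\leadsto_\rho \Pi Y.\,t\,[\exists\vec{y}.\psi]$, then there exist existentially constrained terms $A$ and $B$ such that $A\precsim \Pi X.\,s\,[\exists\vec{x}.\varphi]$, $A\to_\rho B$, and $B\sim \Pi Y.\,t\,[\exists\vec{y}.\psi]$.
   Context: Terms are built over a sorted signature whose function symbols are split into theory symbols (whose argument and result sorts are theory sorts) and term symbols, and a set $\mathcal{V}$ of sorted variables; theory sorts and symbols are interpreted in a fixed model $\mathcal{M}$. Every element of the interpretation of each theory sort is a constant symbol, called a value; $\mathcal{V}al$ denotes the set of values. There is a theory sort of Booleans with standard interpretation and the usual connectives. A constraint is a Boolean-sorted term built from theory symbols and variables; a (possibly existentially quantified) formula is valid if it is true under all valuations of its free variables in $\mathcal{M}$ and satisfiable if true under some. $\mathcal{V}ar(\cdot)$ is the set of variables. A substitution $\sigma$ is a sort-preserving map from variables to terms with finite domain $\mathcal{D}om(\sigma)=\{x\mid \sigma(x)\neq x\}$; $\sigma$ is $X$-valued if $\sigma(X)\subseteq\mathcal{V}al$. An existential constraint $\exists\vec{x}.\varphi$ is a sequence of variables $\vec x$ together with a constraint $\varphi$ with $\{\vec x\}\subseteq\mathcal{V}ar(\varphi)$; its free variables are $\mathcal{FV}ar(\exists\vec x.\varphi)=\mathcal{V}ar(\varphi)\setminus\{\vec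 x\}$. For a substitution $\sigma$, $\sigma\vDash_{\mathcal M}\exists\vec x.\varphi$ means $\sigma$ is $\mathcal{FV}ar(\exists\vec x.\varphi)$-valued and $(\exists\vec x.\varphi)\sigma$ is valid. An existentially constrained term $\Pi X.\,s\,[\exists\vec x.\varphi]$ consists of a set $X$ of variables, a term $s$ and an existential constraint with $\mathcal{FV}ar(\exists\vec x.\varphi)\subseteq X\subseteq\mathcal{V}ar(s)$ and $\{\vec x\}\cap\mathcal{V}ar(s)=\emptyset$; it is satisfiable if $\exists\vec x.\varphi$ is satisfiable. Subsumption: $\Pi X.\,s\,[\exists\vec x.\varphi]\precsim\Pi Y.\,t\,[\exists\vec y.\psi]$ holds if for every $X$-valued substitution $\sigma$ with $\sigma\vDash_{\mathcal M}\exists\vec x.\varphi$ there is a $Y$-valued substitution $\gamma$ with $\gamma\vDash_{\mathcal M}\exists\vec y.\psi$ and $s\sigma=t\gamma$. Equivalence $\sim$ means subsumption in both directions. A constrained rewrite rule $\rho\colon \Pi Z.\,\ell\to r\,[\pi]$ consists of a set $Z$ of variables, terms $\ell,r$ of the same sort and a constraint $\pi$ with $\mathcal{V}ar(\pi)\cup(\mathcal{V}ar(r)\setminus\mathcal{V}ar(\ell))\subseteq Z$; it is left-linear if $\ell$ is linear; $\mathcal{E}x\mathcal{V}ar(\rho)=\mathcal{V}ar(r)\setminus\mathcal{V}ar(\ell)$. Let $\Pi X.\,s\,[\exists\vec x.\varphi]$ be satisfiable, $\rho$ left-linear with $\mathcal{V}ar(\rho)\cap\mathcal{V}ar(s,\varphi)=\emptyset$,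 and $\{\vec z\}=\mathcal{V}ar(\pi)\setminus\mathcal{V}ar(\ell)$. The term has a $\rho$-redex at position $p$ of $s$ using $\gamma$ if (i) $\mathcal{D}om(\gamma)=\mathcal{V}ar(\ell)$, (ii) $s|_p=\ell\gamma$, (iii) $\gamma(x)\in\mathcal{V}al\cup X$ for all $x\in\mathcal{V}ar(\ell)\cap Z$, and (iv) $(\exists\vec x.\varphi)\Rightarrow(\exists\vec z.\pi\gamma)$ is valid; it has a partial $\rho$-redex at $p$ using $\gamma$ if (i)–(iii) hold and (iv') $(\exists\vec x.\varphi)\wedge(\exists\vec z.\pi\gamma)$ is satisfiable. In either case put $t=s[r\gamma]_p$, $\psi=\varphi\wedge\pi\gamma$, $\{\vec y\}=\mathcal{V}ar(\psi)\setminus\mathcal{V}ar(t)$, $Y=\mathcal{E}x\mathcal{V}ar(\rho)\cup(X\cap\mathcal{V}ar(t))$. A $\rho$-redex yields a most general rewrite step $\Pi X.\,s\,[\exists\vec x.\varphi]\to^p_{\rho,\gamma}\Pi Y.\,t\,[\exists\vec y.\psi]$, and a partial $\rho$-redex yields a partial rewrite step $\Pi X.\,s\,[\exists\vec x.\varphi]\leadsto^p_{\rho,\gamma}\Pi Y.\,t\,[\exists\vec y.\psi]$. One writes $\to_\rho$ (resp. $\leadsto_\rho$) if such a step exists for some position, some $\gamma$ and some renamed variant of $\rho$ whose variables are disjoint from those of the source term. -}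

module Defs where

open import Data.Bool using (Bool; true; false; _∧_)
open import Data.Nat using (ℕ; zero; suc)
open import Data.List using (List; []; _∷_; filter)
open import Data.List.Relation.Unary.All using (All; []; _∷_)
open import Data.List.Relation.Unary.Unique.Propositional using (Unique)
open import Data.Product using (Σ; ∃; ∃-syntax; _×_; _,_; proj₁; proj₂)
open import Data.Product.Properties using (≡-dec)
open import Data.Sum using (_⊎_)
open import Data.Empty using (⊥)
open import Relation.Nullary using (¬_; yes; no)
open import Relation.Nullary.Decidable using (¬?)
open import Relation.Binary.Definitions using (DecidableEquality)
open import Relation.Binary.PropositionalEquality using (_≡_; _≢_)
import Data.List.Membership.Propositional as MemP
import Data.List.Membership.DecPropositional as MemD

_iff_ : Set → Set → Set
A iff B = (A → B) × (B → A)

-- The fixed setting: a sorted signature split into theory / term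
-- symbols, a sorted set of variables (infinitely many per sort), and a
-- fixed model M of the theory part in which every element of a theory
-- sort is a constant symbol (a value), and in which there is a Boolean
-- theory sort with standard interpretation and conjunction.

record Setting : Set₁ where
  field
    Sort     : Set
    _≟S_     : DecidableEquality Sort
    Fun      : List Sort → Sort → Set
    Var      : Sort → Set
    _≟V_     : ∀ {σ} → DecidableEquality (Var σ)
    varInf   : ∀ σ (l : List (Var σ)) → ∃[ x ] (¬ MemP._∈_ x l)
    isThS    : Sort → Bool
    isThF    : ∀ {as σ} → Fun as σ → Bool
    thF-sorts : ∀ {as σ} (f : Fun as σ) → isThF f ≡ true →
                All (λ τ → isThS τ ≡ true) as × isThS σ ≡ true
    ⟦_⟧S     : Sort → Set
    ⟦_⟧F     : ∀ {as σ} (f : Fun as σ) → isThF f ≡ true → All ⟦_⟧S as → ⟦ σ ⟧S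
    val      : ∀ {σ} → isThS σ ≡ true → ⟦ σ ⟧S → Fun [] σ
    val-th   : ∀ {σ} (p : isThS σ ≡ true) (a : ⟦ σ ⟧S) → isThF (val p a) ≡ true
    val-⟦⟧   : ∀ {σ} (p : isThS σ ≡ true) (a : ⟦ σ ⟧S) →
               ⟦ val p a ⟧F (val-th p a) [] ≡ a
    boolS    : Sort
    boolS-th : isThS boolS ≡ true
    toBool   : ⟦ boolS ⟧S → Bool
    fromBool : Bool → ⟦ boolS ⟧S
    toBool-fromBool : ∀ b → toBool (fromBool b) ≡ b
    fromBool-toBool : ∀ a → fromBool (toBool a) ≡ a
    andF     : Fun (boolS ∷ boolS ∷ []) boolS
    andF-th  : isThF andF ≡ true
    andF-⟦⟧  : ∀ a b → toBool (⟦ andF ⟧F andF-th (a ∷ b ∷ [])) ≡ toBool a ∧ toBool b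

module Theory (S : Setting) where
  open Setting S public

  V : Set
  V = Σ Sort Var

  _≟_ : DecidableEquality V
  _≟_ = ≡-dec _≟S_ _≟V_

  open MemP public using (_∈_; _∉_)
  open MemD _≟_ using (_∈?_)

  data Term : Sort → Set
  data Terms : List Sort → Set

  data Term where
    var : ∀ {σ} → Var σ → Term σ
    fun : ∀ {as σ} → Fun as σ → Terms as → Term σ

  data Terms where
    []  : Terms []
    _∷_ : ∀ {σ as} → Term σ → Terms as → Terms (σ ∷ as)

  vars  : ∀ {σ} → Term σ → List V
  varsA : ∀ {as} → Terms as → List V
  vars (var {σ} x) = (σ , x) ∷ []
  vars (fun f ts)  = varsA ts
  varsA [] = []
  varsA (t ∷ ts) = Data.List._++_ (vars t) (varsA ts)

  Linear : ∀ {σ} → Term σ → Set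
  Linear t = Unique (vars t)

  data IsTh : ∀ {σ} → Term σ → Set
  data IsThA : ∀ {as} → Terms as → Set
  data IsTh where
    var : ∀ {σ} (x : Var σ) → IsTh (var x)
    fun : ∀ {as σ} (f : Fun as σ) {ts : Terms as} →
          isThF f ≡ true → IsThA ts → IsTh (fun f ts)
  data IsThA where
    []  : IsThA []
    _∷_ : ∀ {σ as} {t : Term σ} {ts : Terms as} → IsTh t → IsThA ts → IsThA (t ∷ ts)

  IsConstraint : Term boolS → Set
  IsConstraint φ = IsTh φ

  IsVal : ∀ {σ} → Term σ → Set
  IsVal {σ} t = Σ (isThS σ ≡ true) λ p → Σ ⟦ σ ⟧S λ a → t ≡ fun (val p a) []

  -- Positions, subterms and replacement:
  -- Rep u u' s p t  means  s|_p = u  and  t = s[u']_p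

  Pos : Set
  Pos = List ℕ

  data Rep {τ} (u u' : Term τ) : ∀ {σ} → Term σ → Pos → Term σ → Set
  data RepA {τ} (u u' : Term τ) : ∀ {as} → Terms as → ℕ → Pos → Terms as → Set
  data Rep {τ} u u' where
    here  : Rep u u' u [] u'
    under : ∀ {as σ} (f : Fun as σ) {ts ts' : Terms as} {i p} →
            RepA u u' ts i p ts' → Rep u u' (fun f ts) (i ∷ p) (fun f ts')
  data RepA {τ} u u' where
    hd : ∀ {σ as} {t t' : Term σ} {ts : Terms as} {p} →
         Rep u u' t p t' → RepA u u' (t ∷ ts) zero p (t' ∷ ts)
    tl : ∀ {σ as} {t : Term σ} {ts ts' : Terms as} {i p} →
         RepA u u' ts i p ts' → RepA u u' (t ∷ ts) (suc i) p (t ∷ ts')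

  RawSubst : Set
  RawSubst = ∀ {σ} → Var σ → Term σ

  record Subst : Set where
    field
      app    : RawSubst
      finite : Σ (List V) λ l → (∀ {σ} (x : Var σ) → app x ≢ var x → (σ , x) ∈ l)
  open Subst public

  _⟨_⟩  : ∀ {σ} → Term σ → RawSubst → Term σ
  _⟨_⟩A : ∀ {as} → Terms as → RawSubst → Terms as
  var x ⟨ θ ⟩ = θ x
  fun f ts ⟨ θ ⟩ = fun f (ts ⟨ θ ⟩A)
  [] ⟨ θ ⟩A = []
  (t ∷ ts) ⟨ θ ⟩A = (t ⟨ θ ⟩) ∷ (ts ⟨ θ ⟩A)

  Valued : Subst → (V → Set) → Set
  Valued θ X = ∀ {σ} (x : Var σ) → X (σ , x) → IsVal (app θ x)

  mask : List V → RawSubst → RawSubst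
  mask xs θ {σ} x with (σ , x) ∈? xs
  ... | yes _ = var x
  ... | no  _ = θ x

  Valuation : Set
  Valuation = ∀ {σ} → Var σ → isThS σ ≡ true → ⟦ σ ⟧S

  data Eval (α : Valuation) : ∀ {σ} → Term σ → ⟦ σ ⟧S → Set
  data EvalA (α : Valuation) : ∀ {as} → Terms as → All ⟦_⟧S as → Set
  data Eval α where
    var : ∀ {σ} (x : Var σ) (p : isThS σ ≡ true) → Eval α (var x) (α x p)
    fun : ∀ {as σ} (f : Fun as σ) {ts : Terms as} {vs} (q : isThF f ≡ true) →
          EvalA α ts vs → Eval α (fun f ts) (⟦ f ⟧F q vs)
  data EvalA α where
    []  : EvalA α [] []
    _∷_ : ∀ {σ as} {t : Term σ} {ts : Terms as} {v vs} →
          Eval α t v → EvalA α ts vs → EvalA α (t ∷ ts) (v ∷ vs)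

  Holds : Valuation → Term boolS → Set
  Holds α φ = ∃[ b ] (Eval α φ b × toBool b ≡ true)

  ExHolds : Valuation → List V → Term boolS → Set
  ExHolds α xs φ =
    Σ Valuation λ α' → ((∀ {σ} (x : Var σ) (p : isThS σ ≡ true) → (σ , x) ∉ xs → α' x p ≡ α x p)
             × Holds α' φ)

  ExValid : List V → Term boolS → Set
  ExValid xs φ = ∀ (α : Valuation) → ExHolds α xs φ

  ExSat : List V → Term boolS → Set
  ExSat xs φ = Σ Valuation λ α → ExHolds α xs φ

  WfExC : List V → Term boolS → Set
  WfExC xs φ = IsConstraint φ × (∀ v → v ∈ xs → v ∈ vars φ)

  FV : List V → Term boolS → V → Set
  FV xs φ v = v ∈ vars φ × v ∉ xs

  _⊨_,_ : Subst → List V → Term boolS → Set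
  θ ⊨ xs , φ = Valued θ (FV xs φ) × ExValid xs (φ ⟨ mask xs (app θ) ⟩)

  record ECT (σ : Sort) : Set where
    constructor Π_∙_[∃_∙_]
    field
      X     : List V
      term  : Term σ
      bound : List V
      con   : Term boolS
  open ECT public

  IsECT : ∀ {σ} → ECT σ → Set
  IsECT A = WfExC (bound A) (con A)
          × (∀ v → FV (bound A) (con A) v → v ∈ X A)
          × (∀ v → v ∈ X A → v ∈ vars (term A))
          × (∀ v → v ∈ bound A → v ∉ vars (term A))

  SatECT : ∀ {σ} → ECT σ → Set
  SatECT A = ExSat (bound A) (con A)

  _≾_ : ∀ {σ} → ECT σ → ECT σ → Set
  A ≾ B = ∀ (θ : Subst) → Valued θ (λ v → v ∈ X A) → θ ⊨ bound A , con A →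
          Σ Subst λ γ → (Valued γ (λ v → v ∈ X B) × γ ⊨ bound B , con B
                  × term A ⟨ app θ ⟩ ≡ term B ⟨ app γ ⟩)

  _∼_ : ∀ {σ} → ECT σ → ECT σ → Set
  A ∼ B = A ≾ B × B ≾ A

  record Rule : Set where
    field
      Z     : List V
      srt   : Sort
      lhs   : Term srt
      rhs   : Term srt
      guard : Term boolS
  open Rule public

  ExVar : Rule → V → Set
  ExVar ρ v = v ∈ vars (rhs ρ) × v ∉ vars (lhs ρ)

  WfRule : Rule → Set
  WfRule ρ = IsConstraint (guard ρ)
           × (∀ v → (v ∈ vars (guard ρ) ⊎ ExVar ρ v) → v ∈ Z ρ)

  LeftLinear : Rule → Set
  LeftLinear ρ = Linear (lhs ρ)

  VarRule : Rule → V → Set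
  VarRule ρ v = v ∈ vars (lhs ρ) ⊎ v ∈ vars (rhs ρ) ⊎ v ∈ vars (guard ρ)

  zs : Rule → List V
  zs ρ = filter (λ v → ¬? (v ∈? vars (lhs ρ))) (vars (guard ρ))

  Renaming : Set
  Renaming = ∀ {σ} → Var σ → Var σ

  renV : Renaming → V → V
  renV r (σ , x) = σ , r x

  renList : Renaming → List V → List V
  renList r = Data.List.map (renV r)

  renSubst : Renaming → RawSubst
  renSubst r x = var (r x)

  renRule : Renaming → Rule → Rule
  renRule r ρ = record
    { Z = renList r (Z ρ) ; srt = srt ρ
    ; lhs = lhs ρ ⟨ renSubst r ⟩ ; rhs = rhs ρ ⟨ renSubst r ⟩
    ; guard = guard ρ ⟨ renSubst r ⟩ }

  InjectiveRen : Renaming → Set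
  InjectiveRen r = ∀ {σ} (x y : Var σ) → r x ≡ r y → x ≡ y

  record StepCore {σ} (A : ECT σ) (ρ : Rule) (p : Pos) (γ : Subst) (B : ECT σ) : Set where
    field
      satisfiable : SatECT A
      leftLinear  : LeftLinear ρ
      disjoint    : ∀ v → VarRule ρ v → v ∈ vars (term A) → ⊥
      disjoint'   : ∀ v → VarRule ρ v → v ∈ vars (con A) → ⊥
      dom         : ∀ {τ} (x : Var τ) → (app γ x ≢ var x) iff ((τ , x) ∈ vars (lhs ρ))
      replace     : Rep (lhs ρ ⟨ app γ ⟩) (rhs ρ ⟨ app γ ⟩) (term A) p (term B)
      valOrX      : ∀ {τ} (x : Var τ) → (τ , x) ∈ vars (lhs ρ) → (τ , x) ∈ Z ρ →
                    IsVal (app γ x) ⊎ (∃[ y ] (app γ x ≡ var y × (τ , y) ∈ X A))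
      conB        : con B ≡ fun andF (con A ∷ (guard ρ ⟨ app γ ⟩ ∷ []))
      boundB      : ∀ v → (v ∈ bound B) iff (v ∈ vars (con B) × v ∉ vars (term B))
      XB          : ∀ v → (v ∈ X B) iff (ExVar ρ v ⊎ (v ∈ X A × v ∈ vars (term B)))

  -- most general rewrite step (condition (iv))
  MGStep : ∀ {σ} → ECT σ → Rule → Pos → Subst → ECT σ → Set
  MGStep A ρ p γ B = StepCore A ρ p γ B
    × (∀ (α : Valuation) → ExHolds α (bound A) (con A) → ExHolds α (zs ρ) (guard ρ ⟨ app γ ⟩))

  -- partial rewrite step (condition (iv'))
  PStep : ∀ {σ} → ECT σ → Rule → Pos → Subst → ECT σ → Set
  PStep A ρ p γ B = StepCore A ρ p γ B
    × (Σ Valuation λ α → (ExHolds α (bound A) (con A) × ExHolds α (zs ρ) (guard ρ ⟨ app γ ⟩)))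

  _→[_]_ : ∀ {σ} → ECT σ → Rule → ECT σ → Set
  A →[ ρ ] B = Σ Renaming λ r → (InjectiveRen r ×
                 Σ Pos λ p → Σ Subst λ γ → MGStep A (renRule r ρ) p γ B)

  _⇝[_]_ : ∀ {σ} → ECT σ → Rule → ECT σ → Set
  A ⇝[ ρ ] B = Σ Renaming λ r → (InjectiveRen r ×
                 Σ Pos λ p → Σ Subst λ γ → PStep A (renRule r ρ) p γ B)

module Submission where

open import Defs
open import Axiom.UniquenessOfIdentityProofs.WithK using (uip)
open import Data.Bool using (Bool; true; false; _∧_)
open import Data.Bool.Properties using (∧-conicalˡ; ∧-conicalʳ)
open import Data.Empty using (⊥; ⊥-elim)
open import Data.List using (List; []; _∷_; _++_; map; filter)
import Data.List.Membership.DecPropositional as DecMembership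
open import Data.List.Membership.Propositional.Properties
  using (∈-++⁺ˡ; ∈-++⁺ʳ; ∈-++⁻; ∈-map⁺; ∈-map⁻; ∈-filter⁺; ∈-filter⁻)
open import Data.List.Relation.Unary.All using (All; []; _∷_)
open import Data.List.Relation.Unary.Any using (here; there)
open import Data.Maybe using (Maybe; just; nothing)
open import Data.Product using (Σ; _×_; _,_; proj₁; proj₂)
open import Data.Sum using (_⊎_; inj₁; inj₂)
open import Relation.Nullary using (¬_; yes; no)
open import Relation.Nullary.Decidable using (¬?; toSum)
open import Relation.Binary.PropositionalEquality

-- Let the partial step rewrite with the renamed rule ρ′ = Π Z. ℓ → r [π] and matcher γ, and let
-- z⃗ = Var(π) ∖ Var(ℓ). The source is restricted to the instances satisfying the guard: A = Π X. s
-- [∃ x⃗ z⃗′. φ ∧ πγ′], where πγ′ is πγ with z⃗ renamed to fresh z⃗′ (the constraint of a redex must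
-- not share variables with the rule). Then A ≾ A₀ by dropping πγ′, condition (iv) holds for A
-- because a witness for z⃗′ is one for z⃗, and (iv') makes A satisfiable. Rewriting A yields B with
-- constraint φ ∧ πγ′ ∧ πγ, equivalent to ψ = φ ∧ πγ since z⃗′ can always copy the values of z⃗.

module Properties (S : Setting) where
  open Theory S
  open DecMembership _≟_ using (_∈?_)

  _∖_ : List V → List V → List V
  xs ∖ ys = filter (λ v → ¬? (v ∈? ys)) xs

  ∈-∖⁺ : ∀ {v xs ys} → v ∈ xs → v ∉ ys → v ∈ xs ∖ ys
  ∈-∖⁺ = ∈-filter⁺ (λ v → ¬? (v ∈? _))

  ∈-∖⁻ : ∀ {v} xs {ys} → v ∈ xs ∖ ys → v ∈ xs × v ∉ ys
  ∈-∖⁻ xs = ∈-filter⁻ (λ v → ¬? (v ∈? _)) {xs = xs}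

  ∈-∖-complement : ∀ {v xs ys} → v ∈ xs → v ∉ xs ∖ ys → v ∈ ys
  ∈-∖-complement {v} {ys = ys} v∈xs v∉xs∖ys with v ∈? ys
  ... | yes v∈ys = v∈ys
  ... | no v∉ys = ⊥-elim (v∉xs∖ys (∈-∖⁺ v∈xs v∉ys))

  ⟨⟩-identity  : ∀ {σ} (u : Term σ) → u ⟨ var ⟩ ≡ u
  ⟨⟩A-identity : ∀ {as} (us : Terms as) → us ⟨ var ⟩A ≡ us
  ⟨⟩-identity (var x) = refl
  ⟨⟩-identity (fun f ts) = cong (fun f) (⟨⟩A-identity ts)
  ⟨⟩A-identity [] = refl
  ⟨⟩A-identity (t ∷ ts) = cong₂ _∷_ (⟨⟩-identity t) (⟨⟩A-identity ts)

  ⟨⟩-∘  : ∀ {σ} (u : Term σ) (θ₁ θ₂ : RawSubst) →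
          u ⟨ θ₁ ⟩ ⟨ θ₂ ⟩ ≡ u ⟨ (λ x → θ₁ x ⟨ θ₂ ⟩) ⟩
  ⟨⟩A-∘ : ∀ {as} (us : Terms as) (θ₁ θ₂ : RawSubst) →
          us ⟨ θ₁ ⟩A ⟨ θ₂ ⟩A ≡ us ⟨ (λ x → θ₁ x ⟨ θ₂ ⟩) ⟩A
  ⟨⟩-∘ (var x) θ₁ θ₂ = refl
  ⟨⟩-∘ (fun f ts) θ₁ θ₂ = cong (fun f) (⟨⟩A-∘ ts θ₁ θ₂)
  ⟨⟩A-∘ [] θ₁ θ₂ = refl
  ⟨⟩A-∘ (t ∷ ts) θ₁ θ₂ = cong₂ _∷_ (⟨⟩-∘ t θ₁ θ₂) (⟨⟩A-∘ ts θ₁ θ₂)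

  vars-⟨⟩⁻  : ∀ {σ} (u : Term σ) (θ : RawSubst) {w} → w ∈ vars (u ⟨ θ ⟩) →
              Σ V λ v → v ∈ vars u × w ∈ vars (θ (proj₂ v))
  varsA-⟨⟩⁻ : ∀ {as} (us : Terms as) (θ : RawSubst) {w} → w ∈ varsA (us ⟨ θ ⟩A) →
              Σ V λ v → v ∈ varsA us × w ∈ vars (θ (proj₂ v))
  vars-⟨⟩⁻ (var {σ} x) θ w∈ = (σ , x) , here refl , w∈
  vars-⟨⟩⁻ (fun f ts) θ w∈ = varsA-⟨⟩⁻ ts θ w∈
  varsA-⟨⟩⁻ (t ∷ ts) θ w∈ with ∈-++⁻ (vars (t ⟨ θ ⟩)) w∈
  ... | inj₁ w∈t with vars-⟨⟩⁻ t θ w∈t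
  ...   | v , v∈t , w∈θv = v , ∈-++⁺ˡ v∈t , w∈θv
  varsA-⟨⟩⁻ (t ∷ ts) θ w∈ | inj₂ w∈ts with varsA-⟨⟩⁻ ts θ w∈ts
  ...   | v , v∈ts , w∈θv = v , ∈-++⁺ʳ (vars t) v∈ts , w∈θv

  vars-⟨⟩⁺  : ∀ {σ} (u : Term σ) (θ : RawSubst) {τ} {x : Var τ} {w} →
              (τ , x) ∈ vars u → w ∈ vars (θ x) → w ∈ vars (u ⟨ θ ⟩)
  varsA-⟨⟩⁺ : ∀ {as} (us : Terms as) (θ : RawSubst) {τ} {x : Var τ} {w} →
              (τ , x) ∈ varsA us → w ∈ vars (θ x) → w ∈ varsA (us ⟨ θ ⟩A)
  vars-⟨⟩⁺ (var x) θ (here refl) w∈ = w∈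
  vars-⟨⟩⁺ (fun f ts) θ x∈ w∈ = varsA-⟨⟩⁺ ts θ x∈ w∈
  varsA-⟨⟩⁺ (t ∷ ts) θ x∈ w∈ with ∈-++⁻ (vars t) x∈
  ... | inj₁ x∈t = ∈-++⁺ˡ (vars-⟨⟩⁺ t θ x∈t w∈)
  ... | inj₂ x∈ts = ∈-++⁺ʳ (vars (t ⟨ θ ⟩)) (varsA-⟨⟩⁺ ts θ x∈ts w∈)

  IsTh-⟨⟩  : ∀ {σ} {u : Term σ} (θ : RawSubst) → IsTh u →
             (∀ {τ} (x : Var τ) → (τ , x) ∈ vars u → IsTh (θ x)) → IsTh (u ⟨ θ ⟩)
  IsThA-⟨⟩ : ∀ {as} {us : Terms as} (θ : RawSubst) → IsThA us →
             (∀ {τ} (x : Var τ) → (τ , x) ∈ varsA us → IsTh (θ x)) → IsThA (us ⟨ θ ⟩A)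
  IsTh-⟨⟩ θ (var x) th = th x (here refl)
  IsTh-⟨⟩ θ (fun f q ths) th = fun f q (IsThA-⟨⟩ θ ths th)
  IsThA-⟨⟩ θ [] th = []
  IsThA-⟨⟩ θ (_∷_ {t = t} th₁ ths) th =
    IsTh-⟨⟩ θ th₁ (λ x x∈ → th x (∈-++⁺ˡ x∈)) ∷ IsThA-⟨⟩ θ ths (λ x x∈ → th x (∈-++⁺ʳ (vars t) x∈))

  IsVal⇒IsTh : ∀ {σ} {u : Term σ} → IsVal u → IsTh u
  IsVal⇒IsTh (p , a , refl) = fun _ (val-th p a) []

  IsVal⇒∉vars : ∀ {σ} {u : Term σ} → IsVal u → ∀ {w} → w ∉ vars u
  IsVal⇒∉vars (p , a , refl) ()

  ≡var-stable : ∀ {σ} {u : Term σ} {x : Var σ} → ¬ (u ≢ var x) → u ≡ var x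
  ≡var-stable {u = var y} {x} u≢̸x with y ≟V x
  ... | yes refl = refl
  ... | no y≢x = ⊥-elim (u≢̸x (λ { refl → y≢x refl }))
  ≡var-stable {u = fun f ts} u≢̸x = ⊥-elim (u≢̸x (λ ()))

  Eval-⟨⟩  : ∀ {σ} (u : Term σ) {θ₁ θ₂ : RawSubst} {β₁ β₂ : Valuation} →
             (∀ {τ} (x : Var τ) → (τ , x) ∈ vars u → ∀ b → Eval β₁ (θ₁ x) b → Eval β₂ (θ₂ x) b) →
             ∀ {b} → Eval β₁ (u ⟨ θ₁ ⟩) b → Eval β₂ (u ⟨ θ₂ ⟩) b
  EvalA-⟨⟩ : ∀ {as} (us : Terms as) {θ₁ θ₂ : RawSubst} {β₁ β₂ : Valuation} →
             (∀ {τ} (x : Var τ) → (τ , x) ∈ varsA us → ∀ b → Eval β₁ (θ₁ x) b → Eval β₂ (θ₂ x) b) →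
             ∀ {bs} → EvalA β₁ (us ⟨ θ₁ ⟩A) bs → EvalA β₂ (us ⟨ θ₂ ⟩A) bs
  Eval-⟨⟩ (var x) pw e = pw x (here refl) _ e
  Eval-⟨⟩ (fun f ts) pw (fun .f q es) = fun f q (EvalA-⟨⟩ ts pw es)
  EvalA-⟨⟩ [] pw [] = []
  EvalA-⟨⟩ (t ∷ ts) pw (e ∷ es) =
    Eval-⟨⟩ t (λ x x∈ → pw x (∈-++⁺ˡ x∈)) e ∷ EvalA-⟨⟩ ts (λ x x∈ → pw x (∈-++⁺ʳ (vars t) x∈)) es

  Holds-⟨⟩ : ∀ (φ : Term boolS) {θ₁ θ₂ : RawSubst} {β₁ β₂ : Valuation} →
             (∀ {τ} (x : Var τ) → (τ , x) ∈ vars φ → ∀ b → Eval β₁ (θ₁ x) b → Eval β₂ (θ₂ x) b) →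
             Holds β₁ (φ ⟨ θ₁ ⟩) → Holds β₂ (φ ⟨ θ₂ ⟩)
  Holds-⟨⟩ φ pw (b , e , b-true) = b , Eval-⟨⟩ φ pw e , b-true

  Eval-var⁻ : ∀ {β : Valuation} {σ} {x : Var σ} {b} → Eval β (var x) b →
              Σ (isThS σ ≡ true) λ p → b ≡ β x p
  Eval-var⁻ (var x p) = p , refl

  Eval-var⁺ : ∀ {β : Valuation} {σ} (x : Var σ) p {b} → b ≡ β x p → Eval β (var x) b
  Eval-var⁺ x p refl = var x p

  Eval-agree : ∀ {σ} (u : Term σ) {β₁ β₂ : Valuation} →
               (∀ {τ} (x : Var τ) p → (τ , x) ∈ vars u → β₁ x p ≡ β₂ x p) →
               ∀ {b} → Eval β₁ u b → Eval β₂ u b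
  Eval-agree u {β₁} {β₂} agree {b} e =
    subst (λ v → Eval β₂ v b) (⟨⟩-identity u)
      (Eval-⟨⟩ u pw (subst (λ v → Eval β₁ v b) (sym (⟨⟩-identity u)) e))
    where
      pw : ∀ {τ} (x : Var τ) → (τ , x) ∈ vars u → ∀ b → Eval β₁ (var x) b → Eval β₂ (var x) b
      pw x x∈ b e with Eval-var⁻ e
      ... | p , refl = Eval-var⁺ x p (agree x p x∈)

  Eval-closed : ∀ {σ} {u : Term σ} {β₁ β₂ : Valuation} → IsVal u →
                ∀ {b} → Eval β₁ u b → Eval β₂ u b
  Eval-closed {u = u} u-val = Eval-agree u (λ x p x∈ → ⊥-elim (IsVal⇒∉vars u-val x∈))

  Eval-theorySort : ∀ {β : Valuation} {σ} {u : Term σ} {b} → Eval β u b → isThS σ ≡ true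
  Eval-theorySort (var x p) = p
  Eval-theorySort (fun f q _) = proj₂ (thF-sorts f q)

  -- A total evaluator; on terms that are not constraints its value is junk. The test on isThF f is
  -- passed to evalFun together with its proof, since abstracting it with 'with' is ill-typed.
  eval    : Valuation → ∀ {σ} → Term σ → isThS σ ≡ true → ⟦ σ ⟧S
  evalA   : Valuation → ∀ {as} → Terms as → All (λ τ → isThS τ ≡ true) as → All ⟦_⟧S as
  evalFun : Valuation → ∀ {as σ} (f : Fun as σ) → Terms as → isThS σ ≡ true →
            (b : Bool) → isThF f ≡ b → ⟦ σ ⟧S
  eval β (var x) p = β x p
  eval β (fun f ts) p = evalFun β f ts p (isThF f) refl
  evalA β [] [] = []
  evalA β (t ∷ ts) (p ∷ ps) = eval β t p ∷ evalA β ts ps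
  evalFun β f ts p true q = ⟦ f ⟧F q (evalA β ts (proj₁ (thF-sorts f q)))
  evalFun β {σ = σ} f ts p false q = β (proj₁ (varInf σ [])) p

  evalFun-theory : ∀ {β : Valuation} {as σ} (f : Fun as σ) (ts : Terms as) p b (e : isThF f ≡ b)
                   (q : isThF f ≡ true) →
                   evalFun β f ts p b e ≡ ⟦ f ⟧F q (evalA β ts (proj₁ (thF-sorts f q)))
  evalFun-theory f ts p true e q rewrite uip e q = refl
  evalFun-theory f ts p false e q with () ← trans (sym e) q

  eval-correct  : ∀ {β : Valuation} {σ} {u : Term σ} {b} → Eval β u b → ∀ p → eval β u p ≡ b
  evalA-correct : ∀ {β : Valuation} {as} {us : Terms as} {bs} → EvalA β us bs → ∀ ps → evalA β us ps ≡ bs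
  eval-correct (var x p) p' rewrite uip p p' = refl
  eval-correct (fun f {ts} q es) p =
    trans (evalFun-theory f ts p (isThF f) refl q) (cong (⟦ f ⟧F q) (evalA-correct es _))
  evalA-correct [] [] = refl
  evalA-correct (e ∷ es) (p ∷ ps) = cong₂ _∷_ (eval-correct e p) (evalA-correct es ps)

  _∧ᶜ_ : Term boolS → Term boolS → Term boolS
  φ ∧ᶜ ψ = fun andF (φ ∷ ψ ∷ [])

  Holds-∧⁻ : ∀ {β : Valuation} φ ψ → Holds β (φ ∧ᶜ ψ) → Holds β φ × Holds β ψ
  Holds-∧⁻ φ ψ (_ , fun _ q (_∷_ {v = a} eφ (_∷_ {v = b} eψ [])) , a∧b)
    rewrite uip q andF-th =
    let a∧b′ = trans (sym (andF-⟦⟧ a b)) a∧b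
    in (a , eφ , ∧-conicalˡ _ _ a∧b′) , (b , eψ , ∧-conicalʳ _ _ a∧b′)

  Holds-∧⁺ : ∀ {β : Valuation} φ ψ → Holds β φ → Holds β ψ → Holds β (φ ∧ᶜ ψ)
  Holds-∧⁺ φ ψ (a , eφ , a-true) (b , eψ , b-true) =
    _ , fun andF andF-th (eφ ∷ eψ ∷ []) , trans (andF-⟦⟧ a b) (cong₂ _∧_ a-true b-true)

  vars-∧⁻ : ∀ φ ψ {v} → v ∈ vars (φ ∧ᶜ ψ) → v ∈ vars φ ⊎ v ∈ vars ψ
  vars-∧⁻ φ ψ v∈ with ∈-++⁻ (vars φ) v∈
  ... | inj₁ v∈φ = inj₁ v∈φ
  ... | inj₂ v∈ψ[] with ∈-++⁻ (vars ψ) v∈ψ[]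
  ...   | inj₁ v∈ψ = inj₂ v∈ψ
  ...   | inj₂ ()

  vars-∧⁺ˡ : ∀ φ ψ {v} → v ∈ vars φ → v ∈ vars (φ ∧ᶜ ψ)
  vars-∧⁺ˡ φ ψ = ∈-++⁺ˡ

  vars-∧⁺ʳ : ∀ φ ψ {v} → v ∈ vars ψ → v ∈ vars (φ ∧ᶜ ψ)
  vars-∧⁺ʳ φ ψ v∈ = ∈-++⁺ʳ (vars φ) (∈-++⁺ˡ v∈)

  mask-∈ : ∀ {xs} {θ : RawSubst} {σ} {x : Var σ} → (σ , x) ∈ xs → mask xs θ x ≡ var x
  mask-∈ {xs} {θ} {σ} {x} x∈ with (σ , x) ∈? xs
  ... | yes _ = refl
  ... | no x∉ = ⊥-elim (x∉ x∈)

  mask-∉ : ∀ {xs} {θ : RawSubst} {σ} {x : Var σ} → (σ , x) ∉ xs → mask xs θ x ≡ θ x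
  mask-∉ {xs} {θ} {σ} {x} x∉ with (σ , x) ∈? xs
  ... | yes x∈ = ⊥-elim (x∉ x∈)
  ... | no _ = refl

  override : List V → Valuation → Valuation → Valuation
  override xs α₁ α₂ {σ} x p with (σ , x) ∈? xs
  ... | yes _ = α₁ x p
  ... | no _ = α₂ x p

  override-∈ : ∀ {xs} {α₁ α₂ : Valuation} {σ} {x : Var σ} {p} → (σ , x) ∈ xs →
               override xs α₁ α₂ x p ≡ α₁ x p
  override-∈ {xs} {σ = σ} {x} x∈ with (σ , x) ∈? xs
  ... | yes _ = refl
  ... | no x∉ = ⊥-elim (x∉ x∈)

  override-∉ : ∀ {xs} {α₁ α₂ : Valuation} {σ} {x : Var σ} {p} → (σ , x) ∉ xs →
               override xs α₁ α₂ x p ≡ α₂ x p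
  override-∉ {xs} {σ = σ} {x} x∉ with (σ , x) ∈? xs
  ... | yes x∈ = ⊥-elim (x∉ x∈)
  ... | no _ = refl

  Eval-mask-∈ : ∀ {xs ys} {θ θ′ : RawSubst} {β β′ : Valuation} {σ} {x : Var σ} →
                (σ , x) ∈ xs → (σ , x) ∈ ys → (∀ p → β x p ≡ β′ x p) →
                ∀ {b} → Eval β (mask xs θ x) b → Eval β′ (mask ys θ′ x) b
  Eval-mask-∈ {xs} {ys} {θ} {θ′} {β} {β′} {x = x} x∈xs x∈ys same {b} e
    with p , refl ← Eval-var⁻ (subst (λ u → Eval β u b) (mask-∈ {xs} {θ} x∈xs) e) =
    subst (λ u → Eval β′ u b) (sym (mask-∈ {ys} {θ′} x∈ys)) (Eval-var⁺ x p (same p))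

  Eval-mask-∉ : ∀ {xs ys} {θ : RawSubst} {β β′ : Valuation} {σ} {x : Var σ} →
                (σ , x) ∉ xs → (σ , x) ∉ ys → IsVal (θ x) →
                ∀ {b} → Eval β (mask xs θ x) b → Eval β′ (mask ys θ x) b
  Eval-mask-∉ {xs} {ys} {θ} {β} {β′} x∉xs x∉ys θx-val {b} e =
    subst (λ u → Eval β′ u b) (sym (mask-∉ {ys} {θ} x∉ys))
      (Eval-closed θx-val (subst (λ u → Eval β u b) (mask-∉ {xs} {θ} x∉xs) e))

  -- Only the occurrences of bound variables in ψ matter, so xs and ys need only agree on vars ψ.
  ExValid-⇒ : ∀ (θ : RawSubst) {xs ys φ ψ} →
              (∀ (β : Valuation) → Holds β (φ ⟨ mask xs θ ⟩) → Holds β (ψ ⟨ mask xs θ ⟩)) →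
              (∀ v → v ∈ vars ψ → (v ∈ xs) iff (v ∈ ys)) →
              (∀ {τ} (x : Var τ) → (τ , x) ∈ vars ψ → (τ , x) ∉ ys → IsVal (θ x)) →
              ExValid xs (φ ⟨ mask xs θ ⟩) → ExValid ys (ψ ⟨ mask ys θ ⟩)
  ExValid-⇒ θ {xs} {ys} {φ} {ψ} φ⇒ψ same-bound free-val valid α with valid α
  ... | α′ , _ , holds-φ = override ys α′ α , (λ x p → override-∉) , Holds-⟨⟩ ψ transfer (φ⇒ψ α′ holds-φ)
    where
      transfer : ∀ {τ} (x : Var τ) → (τ , x) ∈ vars ψ → ∀ b →
                 Eval α′ (mask xs θ x) b → Eval (override ys α′ α) (mask ys θ x) b
      transfer {τ} x x∈ψ b with toSum ((τ , x) ∈? ys)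
      ... | inj₁ x∈ys = Eval-mask-∈ (proj₂ (same-bound _ x∈ψ) x∈ys) x∈ys (λ p → sym (override-∈ x∈ys))
      ... | inj₂ x∉ys = Eval-mask-∉ (λ x∈xs → x∉ys (proj₁ (same-bound _ x∈ψ) x∈xs)) x∉ys (free-val x x∈ψ x∉ys)

  ≾-by-entailment : ∀ {σ} (A B : ECT σ) → term A ≡ term B →
                    (∀ v → v ∈ X B → v ∈ X A) →
                    (∀ v → FV (bound B) (con B) v → v ∈ X A) →
                    (∀ v → v ∈ vars (con B) → (v ∈ bound A) iff (v ∈ bound B)) →
                    (∀ (θ : RawSubst) (β : Valuation) →
                       Holds β (con A ⟨ mask (bound A) θ ⟩) → Holds β (con B ⟨ mask (bound A) θ ⟩)) →
                    A ≾ B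
  ≾-by-entailment A B same-term XB⊆XA FV⊆XA same-bound entails θ θ-val (_ , valid) =
    θ , (λ x x∈ → θ-val x (XB⊆XA _ x∈)) , (free-val , valid′) , cong (_⟨ app θ ⟩) same-term
    where
      free-val : Valued θ (FV (bound B) (con B))
      free-val x fv = θ-val x (FV⊆XA _ fv)
      valid′ : ExValid (bound B) (con B ⟨ mask (bound B) (app θ) ⟩)
      valid′ = ExValid-⇒ (app θ) {bound A} {bound B} {con A} {con B} (entails (app θ)) same-bound
                 (λ x x∈ x∉ → free-val x (x∈ , x∉)) valid

  varsOfSort : ∀ σ → List V → List (Var σ)
  varsOfSort σ [] = []
  varsOfSort σ ((σ′ , y) ∷ vs) with σ′ ≟S σ
  ... | yes refl = y ∷ varsOfSort σ vs
  ... | no _ = varsOfSort σ vs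

  ∈-varsOfSort : ∀ {σ} {y : Var σ} vs → (σ , y) ∈ vs → y ∈ varsOfSort σ vs
  ∈-varsOfSort {σ} ((σ′ , y′) ∷ vs) y∈ with σ′ ≟S σ | y∈
  ... | yes refl | here refl = here refl
  ... | yes refl | there y∈vs = there (∈-varsOfSort vs y∈vs)
  ... | no σ′≢σ | here refl = ⊥-elim (σ′≢σ refl)
  ... | no _ | there y∈vs = ∈-varsOfSort vs y∈vs

  freshVar : ∀ σ → List V → Var σ
  freshVar σ avoid = proj₁ (varInf σ (varsOfSort σ avoid))

  freshVar-∉ : ∀ σ avoid → (σ , freshVar σ avoid) ∉ avoid
  freshVar-∉ σ avoid fresh∈ = proj₂ (varInf σ (varsOfSort σ avoid)) (∈-varsOfSort avoid fresh∈)

  update : {F : Sort → Set} → (∀ {τ} → Var τ → F τ) → ∀ {σ} → Var σ → F σ → ∀ {τ} → Var τ → F τ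
  update f {σ} x a {τ} y with (σ , x) ≟ (τ , y)
  ... | yes refl = a
  ... | no _ = f y

  update-≡ : ∀ {F : Sort → Set} {f : ∀ {τ} → Var τ → F τ} {σ} {x : Var σ} {a} → update f x a x ≡ a
  update-≡ {σ = σ} {x} with (σ , x) ≟ (σ , x)
  ... | yes refl = refl
  ... | no x≢x = ⊥-elim (x≢x refl)

  update-≢ : ∀ {F : Sort → Set} {f : ∀ {τ} → Var τ → F τ} {σ} {x : Var σ} {a} {τ} {y : Var τ} →
             (σ , x) ≢ (τ , y) → update f x a y ≡ f y
  update-≢ {σ = σ} {x} {τ = τ} {y} x≢y with (σ , x) ≟ (τ , y)
  ... | yes refl = ⊥-elim (x≢y refl)
  ... | no _ = refl

  record FreshRenaming (ks avoid : List V) : Set where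
    field
      ren       : Renaming
      unren     : ∀ {σ} → Var σ → Maybe (Var σ)
      ren-∉     : ∀ {σ} {x : Var σ} → (σ , x) ∉ ks → ren x ≡ x
      ren-fresh : ∀ {σ} {x : Var σ} → (σ , x) ∈ ks → (σ , ren x) ∉ avoid
      unren-ren : ∀ {σ} {x : Var σ} → (σ , x) ∈ ks → unren (ren x) ≡ just x
      ren-unren : ∀ {σ} {w z : Var σ} → unren w ≡ just z → (σ , z) ∈ ks × ren z ≡ w

  FreshRenaming-∷-∈ : ∀ {k ks avoid} → k ∈ ks → FreshRenaming ks avoid → FreshRenaming (k ∷ ks) avoid
  FreshRenaming-∷-∈ k∈ks R = record
    { ren = ren ; unren = unren
    ; ren-∉ = λ x∉ → ren-∉ (λ x∈ → x∉ (there x∈))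
    ; ren-fresh = λ { (here refl) → ren-fresh k∈ks ; (there x∈) → ren-fresh x∈ }
    ; unren-ren = λ { (here refl) → unren-ren k∈ks ; (there x∈) → unren-ren x∈ }
    ; ren-unren = λ eq → there (proj₁ (ren-unren eq)) , proj₂ (ren-unren eq)
    }
    where open FreshRenaming R

  FreshRenaming-∷-∉ : ∀ {σ} {k y : Var σ} {ks avoid} → (σ , k) ∉ ks → (σ , y) ∉ avoid →
                      FreshRenaming ks ((σ , y) ∷ avoid) → FreshRenaming ((σ , k) ∷ ks) avoid
  FreshRenaming-∷-∉ {σ} {k} {y} {ks} {avoid} k∉ks y∉avoid R = record
    { ren = ren′ ; unren = unren′
    ; ren-∉ = λ x∉ → trans (update-≢ (λ eq → x∉ (here (sym eq)))) (ren-∉ (λ x∈ → x∉ (there x∈)))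
    ; ren-fresh = ren′-fresh ; unren-ren = unren′-ren′ ; ren-unren = ren′-unren′ }
    where
      open FreshRenaming R
      ren′ : Renaming
      ren′ = update ren k y
      unren′ : ∀ {τ} → Var τ → Maybe (Var τ)
      unren′ = update unren y (just k)
      k≢ks : ∀ {τ} {x : Var τ} → (τ , x) ∈ ks → (σ , k) ≢ (τ , x)
      k≢ks x∈ks refl = k∉ks x∈ks
      ren′-ks : ∀ {τ} {x : Var τ} → (τ , x) ∈ ks → ren′ x ≡ ren x
      ren′-ks x∈ks = update-≢ (k≢ks x∈ks)
      ren′-fresh : ∀ {τ} {x : Var τ} → (τ , x) ∈ (σ , k) ∷ ks → (τ , ren′ x) ∉ avoid
      ren′-fresh (here refl) rewrite update-≡ {f = ren} {x = k} {y} = y∉avoid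
      ren′-fresh (there x∈ks) rewrite ren′-ks x∈ks = λ r∈ → ren-fresh x∈ks (there r∈)
      unren′-ren′ : ∀ {τ} {x : Var τ} → (τ , x) ∈ (σ , k) ∷ ks → unren′ (ren′ x) ≡ just x
      unren′-ren′ (here refl) rewrite update-≡ {f = ren} {x = k} {y} = update-≡
      unren′-ren′ (there x∈ks) rewrite ren′-ks x∈ks =
        trans (update-≢ (λ eq → ren-fresh x∈ks (here (sym eq)))) (unren-ren x∈ks)
      ren′-unren′ : ∀ {τ} {w z : Var τ} → unren′ w ≡ just z → (τ , z) ∈ (σ , k) ∷ ks × ren′ z ≡ w
      ren′-unren′ {τ} {w} eq with (σ , y) ≟ (τ , w)
      ren′-unren′ refl | yes refl = here refl , update-≡
      ... | no y≢w with ren-unren eq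
      ...   | z∈ks , refl = there z∈ks , ren′-ks z∈ks

  freshRenaming : ∀ ks avoid → FreshRenaming ks avoid
  freshRenaming [] avoid = record
    { ren = λ x → x ; unren = λ _ → nothing
    ; ren-∉ = λ _ → refl ; ren-fresh = λ () ; unren-ren = λ () ; ren-unren = λ () }
  freshRenaming ((σ , k) ∷ ks) avoid with (σ , k) ∈? ks
  ... | yes k∈ks = FreshRenaming-∷-∈ k∈ks (freshRenaming ks avoid)
  ... | no k∉ks =
    FreshRenaming-∷-∉ k∉ks (freshVar-∉ σ avoid) (freshRenaming ks ((σ , freshVar σ avoid) ∷ avoid))

  module _ {ks avoid} (R : FreshRenaming ks avoid) where
    open FreshRenaming R

    ren-image-fresh : ∀ {v} → v ∈ map (renV ren) ks → v ∉ avoid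
    ren-image-fresh v∈ with ∈-map⁻ (renV ren) v∈
    ... | _ , k∈ , refl = ren-fresh k∈

    unrenValuation : Valuation → Valuation → Valuation
    unrenValuation g h w p with unren w
    ... | just z = g z p
    ... | nothing = h w p

    unrenValuation-ren : ∀ {g h : Valuation} {σ} {x : Var σ} {p} → (σ , x) ∈ ks →
                         unrenValuation g h (ren x) p ≡ g x p
    unrenValuation-ren {x = x} x∈ks with unren (ren x) | unren-ren x∈ks
    ... | just _ | refl = refl

    unrenValuation-∉ : ∀ {g h : Valuation} {σ} {w : Var σ} {p} → (σ , w) ∉ map (renV ren) ks →
                       unrenValuation g h w p ≡ h w p
    unrenValuation-∉ {w = w} w∉ with unren w in eq
    ... | nothing = refl
    ... | just z with z∈ks , refl ← ren-unren eq = ⊥-elim (w∉ (∈-map⁺ (renV ren) z∈ks))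

    unrenValuation-avoid : ∀ {g h : Valuation} {σ} {w : Var σ} {p} → (σ , w) ∈ avoid →
                           unrenValuation g h w p ≡ h w p
    unrenValuation-avoid w∈ = unrenValuation-∉ (λ w∈img → ren-image-fresh w∈img w∈)

  module PartialToMostGeneral {σ} (A₀ B₀ : ECT σ) (ρ : Rule)
      (wf-A₀ : IsECT A₀) (wf-B₀ : IsECT B₀) (wf-ρ : WfRule ρ)
      (r : Renaming) (p : Pos) (γ : Subst) (step : StepCore A₀ (renRule r ρ) p γ B₀) where

    module C = StepCore step

    ρ′ : Rule
    ρ′ = renRule r ρ

    s t : Term σ
    s = term A₀
    t = term B₀

    φ ψ πγ : Term boolS
    φ = con A₀
    ψ = con B₀
    πγ = guard ρ′ ⟨ app γ ⟩

    X₀ xs₀ Y₀ zs′ : List V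
    X₀ = X A₀
    xs₀ = bound A₀
    Y₀ = X B₀
    zs′ = zs ρ′

    xs₀⊆φ : ∀ v → v ∈ xs₀ → v ∈ vars φ
    xs₀⊆φ = proj₂ (proj₁ wf-A₀)

    FV₀⊆X₀ : ∀ v → FV xs₀ φ v → v ∈ X₀
    FV₀⊆X₀ = proj₁ (proj₂ wf-A₀)

    X₀⊆s : ∀ v → v ∈ X₀ → v ∈ vars s
    X₀⊆s = proj₁ (proj₂ (proj₂ wf-A₀))

    xs₀∉s : ∀ v → v ∈ xs₀ → v ∉ vars s
    xs₀∉s = proj₂ (proj₂ (proj₂ wf-A₀))

    FV-B₀⊆Y₀ : ∀ v → FV (bound B₀) ψ v → v ∈ Y₀
    FV-B₀⊆Y₀ = proj₁ (proj₂ wf-B₀)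

    ψ-≡ : ψ ≡ φ ∧ᶜ πγ
    ψ-≡ = C.conB

    φ⊆ψ : ∀ {v} → v ∈ vars φ → v ∈ vars ψ
    φ⊆ψ v∈ = subst (λ c → _ ∈ vars c) (sym ψ-≡) (vars-∧⁺ˡ φ πγ v∈)

    πγ⊆ψ : ∀ {v} → v ∈ vars πγ → v ∈ vars ψ
    πγ⊆ψ v∈ = subst (λ c → _ ∈ vars c) (sym ψ-≡) (vars-∧⁺ʳ φ πγ v∈)

    ψ⊆φ∪πγ : ∀ {v} → v ∈ vars ψ → v ∈ vars φ ⊎ v ∈ vars πγ
    ψ⊆φ∪πγ v∈ = vars-∧⁻ φ πγ (subst (λ c → _ ∈ vars c) ψ-≡ v∈)

    bound-B₀ : ∀ {v} → v ∈ vars ψ → (v ∈ bound B₀) iff (v ∉ vars t)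
    bound-B₀ v∈ψ = (λ v∈ys → proj₂ (proj₁ (C.boundB _) v∈ys)) , (λ v∉t → proj₂ (C.boundB _) (v∈ψ , v∉t))

    t∩ψ⊆Y₀ : ∀ {v} → v ∈ vars ψ → v ∈ vars t → v ∈ Y₀
    t∩ψ⊆Y₀ v∈ψ v∈t = FV-B₀⊆Y₀ _ (v∈ψ , λ v∈ys → proj₁ (bound-B₀ v∈ψ) v∈ys v∈t)

    -- The copies of zs′ must be fresh for every term, constraint and rule variable in sight.
    avoid : List V
    avoid = vars s ++ vars t ++ vars ψ ++ vars (lhs ρ′) ++ vars (rhs ρ′) ++ vars (guard ρ′)

    avoid-s : ∀ {v} → v ∈ vars s → v ∈ avoid
    avoid-s = ∈-++⁺ˡ

    avoid-t : ∀ {v} → v ∈ vars t → v ∈ avoid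
    avoid-t v∈ = ∈-++⁺ʳ (vars s) (∈-++⁺ˡ v∈)

    avoid-ψ : ∀ {v} → v ∈ vars ψ → v ∈ avoid
    avoid-ψ v∈ = ∈-++⁺ʳ (vars s) (∈-++⁺ʳ (vars t) (∈-++⁺ˡ v∈))

    avoid-ρ′ : ∀ {v} → VarRule ρ′ v → v ∈ avoid
    avoid-ρ′ v∈ = ∈-++⁺ʳ (vars s) (∈-++⁺ʳ (vars t) (∈-++⁺ʳ (vars ψ) (in-rule v∈)))
      where
        in-rule : ∀ {v} → VarRule ρ′ v → v ∈ vars (lhs ρ′) ++ vars (rhs ρ′) ++ vars (guard ρ′)
        in-rule (inj₁ v∈ℓ) = ∈-++⁺ˡ v∈ℓ
        in-rule (inj₂ (inj₁ v∈r)) = ∈-++⁺ʳ (vars (lhs ρ′)) (∈-++⁺ˡ v∈r)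
        in-rule (inj₂ (inj₂ v∈π)) = ∈-++⁺ʳ (vars (lhs ρ′)) (∈-++⁺ʳ (vars (rhs ρ′)) v∈π)

    R : FreshRenaming zs′ avoid
    R = freshRenaming zs′ avoid
    open FreshRenaming R

    zs′-copy : List V
    zs′-copy = map (renV ren) zs′

    copy-fresh : ∀ {v} → v ∈ zs′-copy → v ∉ avoid
    copy-fresh = ren-image-fresh R

    zs′⁻ : ∀ {v} → v ∈ zs′ → v ∈ vars (guard ρ′) × v ∉ vars (lhs ρ′)
    zs′⁻ = ∈-∖⁻ (vars (guard ρ′))

    γ-zs′ : ∀ {τ} {x : Var τ} → (τ , x) ∈ zs′ → app γ x ≡ var x
    γ-zs′ {x = x} x∈ = ≡var-stable (λ γx≢x → proj₂ (zs′⁻ x∈) (proj₁ (C.dom x) γx≢x))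

    guard⊆Z : ∀ {v} → v ∈ vars (guard ρ′) → v ∈ Z ρ′
    guard⊆Z v∈ with vars-⟨⟩⁻ (guard ρ) (renSubst r) v∈
    ... | _ , u∈ , here refl = ∈-map⁺ (renV r) (proj₂ wf-ρ _ (inj₁ u∈))

    -- γ is the identity on zs′ and maps the other guard variables to values or variables of X₀.
    vars-πγ : ∀ {w} → w ∈ vars πγ → w ∈ zs′ ⊎ (w ∈ vars s × w ∈ X₀)
    vars-πγ w∈ with vars-⟨⟩⁻ (guard ρ′) (app γ) w∈
    ... | (τ , x) , x∈π , w∈γx with (τ , x) ∈? zs′
    ...   | yes x∈zs′ rewrite γ-zs′ x∈zs′ with here refl ← w∈γx = inj₁ x∈zs′
    ...   | no x∉zs′ with C.valOrX x (∈-∖-complement x∈π x∉zs′) (guard⊆Z x∈π)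
    ...     | inj₁ γx-val = ⊥-elim (IsVal⇒∉vars γx-val w∈γx)
    ...     | inj₂ (y , γx≡y , y∈X₀) rewrite γx≡y with here refl ← w∈γx = inj₂ (X₀⊆s _ y∈X₀ , y∈X₀)

    zs′⊆πγ : ∀ {v} → v ∈ zs′ → v ∈ vars πγ
    zs′⊆πγ {τ , x} x∈ = vars-⟨⟩⁺ (guard ρ′) (app γ) (proj₁ (zs′⁻ x∈))
                          (subst (λ u → (τ , x) ∈ vars u) (sym (γ-zs′ x∈)) (here refl))

    zs′∉s : ∀ {v} → v ∈ zs′ → v ∉ vars s
    zs′∉s v∈ = C.disjoint _ (inj₂ (inj₂ (proj₁ (zs′⁻ v∈))))

    IsTh-πγ : IsTh πγ
    IsTh-πγ = IsTh-⟨⟩ (app γ) (IsTh-⟨⟩ (renSubst r) (proj₁ wf-ρ) (λ x _ → var (r x))) IsTh-γ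
      where
        IsTh-γ : ∀ {τ} (x : Var τ) → (τ , x) ∈ vars (guard ρ′) → IsTh (app γ x)
        IsTh-γ {τ} x x∈π with (τ , x) ∈? zs′
        ... | yes x∈zs′ rewrite γ-zs′ x∈zs′ = var x
        ... | no x∉zs′ with C.valOrX x (∈-∖-complement x∈π x∉zs′) (guard⊆Z x∈π)
        ...   | inj₁ γx-val = IsVal⇒IsTh γx-val
        ...   | inj₂ (y , γx≡y , _) rewrite γx≡y = var y

    πγ′ : Term boolS
    πγ′ = πγ ⟨ renSubst ren ⟩

    vars-πγ′ : ∀ {w} → w ∈ vars πγ′ → w ∈ zs′-copy ⊎ (w ∈ vars s × w ∈ X₀ × w ∈ vars πγ)
    vars-πγ′ w∈ with vars-⟨⟩⁻ πγ (renSubst ren) w∈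
    ... | (τ , x) , x∈πγ , here refl with vars-πγ x∈πγ
    ...   | inj₁ x∈zs′ = inj₁ (∈-map⁺ (renV ren) x∈zs′)
    ...   | inj₂ (x∈s , x∈X₀) rewrite ren-∉ {x = x} (λ x∈zs′ → zs′∉s x∈zs′ x∈s) = inj₂ (x∈s , x∈X₀ , x∈πγ)

    copy⊆πγ′ : ∀ {τ} {x : Var τ} → (τ , x) ∈ zs′ → (τ , ren x) ∈ vars πγ′
    copy⊆πγ′ x∈ = vars-⟨⟩⁺ πγ (renSubst ren) (zs′⊆πγ x∈) (here refl)

    xsA : List V
    xsA = xs₀ ++ zs′-copy

    conA conB : Term boolS
    conA = φ ∧ᶜ πγ′
    conB = conA ∧ᶜ πγ

    ysB : List V
    ysB = vars conB ∖ vars t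

    A B : ECT σ
    A = Π X₀ ∙ s [∃ xsA ∙ conA ]
    B = Π Y₀ ∙ t [∃ ysB ∙ conB ]

    IsTh-conA : IsTh conA
    IsTh-conA = fun andF andF-th
                  (proj₁ (proj₁ wf-A₀) ∷ IsTh-⟨⟩ (renSubst ren) IsTh-πγ (λ x _ → var (ren x)) ∷ [])

    IsECT-A : IsECT A
    IsECT-A = (IsTh-conA , xsA⊆conA) , FV⊆X₀ , X₀⊆s , xsA∉s
      where
        xsA⊆conA : ∀ v → v ∈ xsA → v ∈ vars conA
        xsA⊆conA v v∈ with ∈-++⁻ xs₀ v∈
        ... | inj₁ v∈xs₀ = vars-∧⁺ˡ φ πγ′ (xs₀⊆φ v v∈xs₀)
        ... | inj₂ v∈copy with ∈-map⁻ (renV ren) v∈copy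
        ...   | _ , x∈zs′ , refl = vars-∧⁺ʳ φ πγ′ (copy⊆πγ′ x∈zs′)
        FV⊆X₀ : ∀ v → FV xsA conA v → v ∈ X₀
        FV⊆X₀ v (v∈ , v∉) with vars-∧⁻ φ πγ′ v∈
        ... | inj₁ v∈φ = FV₀⊆X₀ v (v∈φ , λ v∈xs₀ → v∉ (∈-++⁺ˡ v∈xs₀))
        ... | inj₂ v∈πγ′ with vars-πγ′ v∈πγ′
        ...   | inj₁ v∈copy = ⊥-elim (v∉ (∈-++⁺ʳ xs₀ v∈copy))
        ...   | inj₂ (_ , v∈X₀ , _) = v∈X₀
        xsA∉s : ∀ v → v ∈ xsA → v ∉ vars s
        xsA∉s v v∈ with ∈-++⁻ xs₀ v∈
        ... | inj₁ v∈xs₀ = xs₀∉s v v∈xs₀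
        ... | inj₂ v∈copy = λ v∈s → copy-fresh v∈copy (avoid-s v∈s)

    ψ⊆conB : ∀ {v} → v ∈ vars ψ → v ∈ vars conB
    ψ⊆conB v∈ with ψ⊆φ∪πγ v∈
    ... | inj₁ v∈φ = vars-∧⁺ˡ conA πγ (vars-∧⁺ˡ φ πγ′ v∈φ)
    ... | inj₂ v∈πγ = vars-∧⁺ʳ conA πγ v∈πγ

    FV-B⊆Y₀ : ∀ v → FV ysB conB v → v ∈ Y₀
    FV-B⊆Y₀ v (v∈ , v∉) with ∈-∖-complement v∈ v∉ | vars-∧⁻ conA πγ v∈
    ... | v∈t | inj₂ v∈πγ = t∩ψ⊆Y₀ (πγ⊆ψ v∈πγ) v∈t
    ... | v∈t | inj₁ v∈conA with vars-∧⁻ φ πγ′ v∈conA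
    ...   | inj₁ v∈φ = t∩ψ⊆Y₀ (φ⊆ψ v∈φ) v∈t
    ...   | inj₂ v∈πγ′ with vars-πγ′ v∈πγ′
    ...     | inj₁ v∈copy = ⊥-elim (copy-fresh v∈copy (avoid-t v∈t))
    ...     | inj₂ (_ , _ , v∈πγ) = t∩ψ⊆Y₀ (πγ⊆ψ v∈πγ) v∈t

    IsECT-B : IsECT B
    IsECT-B = (fun andF andF-th (IsTh-conA ∷ IsTh-πγ ∷ []) , (λ v v∈ → proj₁ (∈-∖⁻ (vars conB) v∈))) ,
              FV-B⊆Y₀ , proj₁ (proj₂ (proj₂ wf-B₀)) , (λ v v∈ → proj₂ (∈-∖⁻ (vars conB) v∈))

    A≾A₀ : A ≾ A₀
    A≾A₀ = ≾-by-entailment A A₀ refl (λ _ v∈ → v∈) FV₀⊆X₀ same-bound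
             (λ θ β holds → proj₁ (Holds-∧⁻ _ _ holds))
      where
        same-bound : ∀ v → v ∈ vars φ → (v ∈ xsA) iff (v ∈ xs₀)
        same-bound v v∈φ = to , ∈-++⁺ˡ
          where
            to : v ∈ xsA → v ∈ xs₀
            to v∈ with ∈-++⁻ xs₀ v∈
            ... | inj₁ v∈xs₀ = v∈xs₀
            ... | inj₂ v∈copy = ⊥-elim (copy-fresh v∈copy (avoid-ψ (φ⊆ψ v∈φ)))

    same-bound-B : ∀ v → v ∈ vars ψ → (v ∈ ysB) iff (v ∈ bound B₀)
    same-bound-B v v∈ψ = (λ v∈ysB → proj₂ (bound-B₀ v∈ψ) (proj₂ (∈-∖⁻ (vars conB) v∈ysB))) ,
                         (λ v∈ys₀ → ∈-∖⁺ (ψ⊆conB v∈ψ) (proj₁ (bound-B₀ v∈ψ) v∈ys₀))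

    B≾B₀ : B ≾ B₀
    B≾B₀ = ≾-by-entailment B B₀ refl (λ _ v∈ → v∈) FV-B₀⊆Y₀ same-bound-B entails
      where
        entails : ∀ (θ : RawSubst) (β : Valuation) →
                  Holds β (conB ⟨ mask ysB θ ⟩) → Holds β (ψ ⟨ mask ysB θ ⟩)
        entails θ β holds with Holds-∧⁻ _ _ holds
        ... | holds-conA , holds-πγ = subst (λ c → Holds β (c ⟨ mask ysB θ ⟩)) (sym ψ-≡)
                                        (Holds-∧⁺ _ _ (proj₁ (Holds-∧⁻ _ _ holds-conA)) holds-πγ)

    copy∈ysB : ∀ {τ} {x : Var τ} → (τ , x) ∈ zs′ → (τ , ren x) ∈ ysB
    copy∈ysB x∈ = ∈-∖⁺ (vars-∧⁺ˡ conA πγ (vars-∧⁺ʳ φ πγ′ (copy⊆πγ′ x∈))) (λ x∈t → ren-fresh x∈ (avoid-t x∈t))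

    -- A witness α′ for ψ extends to conB by giving each copy the value of its original.
    module CopyWitness (θ : RawSubst)
        (free-val : ∀ {τ} (x : Var τ) → (τ , x) ∈ vars ψ → (τ , x) ∉ bound B₀ → IsVal (θ x))
        (α α′ : Valuation) where

      α″ : Valuation
      α″ = override ysB (unrenValuation R (λ z → eval α′ (mask (bound B₀) θ z)) α′) α

      α″-ψ : ∀ {τ} (x : Var τ) → (τ , x) ∈ vars ψ → ∀ b →
             Eval α′ (mask (bound B₀) θ x) b → Eval α″ (mask ysB θ x) b
      α″-ψ {τ} x x∈ψ b with toSum ((τ , x) ∈? ysB)
      ... | inj₁ x∈ysB = Eval-mask-∈ (proj₁ (same-bound-B _ x∈ψ) x∈ysB) x∈ysB
                          (λ p → sym (trans (override-∈ x∈ysB) (unrenValuation-avoid R (avoid-ψ x∈ψ))))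
      ... | inj₂ x∉ysB = Eval-mask-∉ (λ x∈ys₀ → x∉ysB (proj₂ (same-bound-B _ x∈ψ) x∈ys₀)) x∉ysB
                         (free-val x x∈ψ (λ x∈ys₀ → x∉ysB (proj₂ (same-bound-B _ x∈ψ) x∈ys₀)))

      α″-copy : ∀ {τ} (x : Var τ) → (τ , x) ∈ vars πγ → ∀ b →
                Eval α′ (mask (bound B₀) θ x) b → Eval α″ (mask ysB θ (ren x)) b
      α″-copy {τ} x x∈πγ b e with (τ , x) ∈? zs′
      ... | no x∉zs′ rewrite ren-∉ x∉zs′ = α″-ψ x (πγ⊆ψ x∈πγ) b e
      ... | yes x∈zs′ rewrite mask-∈ {ysB} {θ} (copy∈ysB x∈zs′) =
        Eval-var⁺ (ren x) τ-theory (sym (trans (override-∈ (copy∈ysB x∈zs′))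
                                          (trans (unrenValuation-ren R x∈zs′) (eval-correct e τ-theory))))
        where
          τ-theory : isThS τ ≡ true
          τ-theory = Eval-theorySort e

    B₀≾B : B₀ ≾ B
    B₀≾B θ θ-val (free-val₀ , valid₀) = θ , θ-val , (free-val , valid) , refl
      where
        free-val : Valued θ (FV ysB conB)
        free-val x fv = θ-val x (FV-B⊆Y₀ _ fv)
        m₀ m : RawSubst
        m₀ = mask (bound B₀) (app θ)
        m = mask ysB (app θ)
        valid : ExValid ysB (conB ⟨ m ⟩)
        valid α with valid₀ α
        ... | α′ , _ , holds-ψ with Holds-∧⁻ _ _ (subst (λ c → Holds α′ (c ⟨ m₀ ⟩)) ψ-≡ holds-ψ)
        ...   | holds-φ , holds-πγ =
          α″ , (λ x p → override-∉) ,
          Holds-∧⁺ _ _ (Holds-∧⁺ _ _ (Holds-⟨⟩ φ (λ x x∈ → α″-ψ x (φ⊆ψ x∈)) holds-φ) holds-πγ′)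
                       (Holds-⟨⟩ πγ (λ x x∈ → α″-ψ x (πγ⊆ψ x∈)) holds-πγ)
          where
            open CopyWitness (app θ) (λ x x∈ x∉ → free-val₀ x (x∈ , x∉)) α α′
            holds-πγ′ : Holds α″ (πγ′ ⟨ m ⟩)
            holds-πγ′ = subst (Holds α″) (sym (⟨⟩-∘ πγ (renSubst ren) m)) (Holds-⟨⟩ πγ α″-copy holds-πγ)

    -- Condition (iv') provides witnesses for φ and for πγ; the copies let them live side by side.
    satisfiable-A : (Σ Valuation λ α → ExHolds α xs₀ φ × ExHolds α zs′ πγ) → SatECT A
    satisfiable-A (α₀ , (α₁ , α₁-agrees , holds-φ) , (α₂ , α₂-agrees , holds-πγ)) =
      α₀ , α* , α*-agrees , Holds-∧⁺ _ _ holds-φ* holds-πγ′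
      where
        α* : Valuation
        α* = override xs₀ α₁ (unrenValuation R α₂ α₀)
        α*-agrees : ∀ {τ} (x : Var τ) q → (τ , x) ∉ xsA → α* x q ≡ α₀ x q
        α*-agrees x q x∉ = trans (override-∉ {xs₀} {α₁} (λ x∈ → x∉ (∈-++⁺ˡ x∈)))
                                 (unrenValuation-∉ R (λ x∈ → x∉ (∈-++⁺ʳ xs₀ x∈)))
        holds-φ* : Holds α* φ
        holds-φ* = let (b , e , b-true) = holds-φ in b , Eval-agree φ agree e , b-true
          where
            agree : ∀ {τ} (x : Var τ) q → (τ , x) ∈ vars φ → α₁ x q ≡ α* x q
            agree {τ} x q x∈φ with toSum ((τ , x) ∈? xs₀)
            ... | inj₁ x∈xs₀ = sym (override-∈ x∈xs₀)
            ... | inj₂ x∉xs₀ = trans (α₁-agrees x q x∉xs₀)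
                                 (sym (trans (override-∉ x∉xs₀) (unrenValuation-avoid R (avoid-ψ (φ⊆ψ x∈φ)))))
        copy : ∀ {τ} (x : Var τ) → (τ , x) ∈ vars πγ → ∀ b → Eval α₂ (var x) b → Eval α* (var (ren x)) b
        copy {τ} x x∈πγ b e with Eval-var⁻ e | vars-πγ x∈πγ
        ... | q , refl | inj₁ x∈zs′ =
          Eval-var⁺ (ren x) q
            (sym (trans (override-∉ (λ x∈xs₀ → ren-fresh x∈zs′ (avoid-ψ (φ⊆ψ (xs₀⊆φ _ x∈xs₀)))))
                        (unrenValuation-ren R x∈zs′)))
        ... | q , refl | inj₂ (x∈s , _) rewrite ren-∉ {x = x} (λ x∈zs′ → zs′∉s x∈zs′ x∈s) =
          Eval-var⁺ x q (trans (α₂-agrees x q (λ x∈zs′ → zs′∉s x∈zs′ x∈s))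
                               (sym (trans (override-∉ (λ x∈xs₀ → xs₀∉s _ x∈xs₀ x∈s))
                                           (unrenValuation-avoid R (avoid-s x∈s)))))
        holds-πγ′ : Holds α* πγ′
        holds-πγ′ = Holds-⟨⟩ πγ copy (subst (Holds α₂) (sym (⟨⟩-identity πγ)) holds-πγ)

    -- Condition (iv): a witness for conA yields one for πγ by reading the copies.
    guard-entailed : ∀ (α : Valuation) → ExHolds α xsA conA → ExHolds α zs′ πγ
    guard-entailed α (α′ , α′-agrees , holds-conA) =
      α″ , (λ x q → override-∉) , subst (Holds α″) (⟨⟩-identity πγ) (Holds-⟨⟩ πγ original holds-πγ′)
      where
        holds-πγ′ : Holds α′ πγ′
        holds-πγ′ = proj₂ (Holds-∧⁻ _ _ holds-conA)
        α″ : Valuation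
        α″ = override zs′ (λ w → α′ (ren w)) α
        original : ∀ {τ} (x : Var τ) → (τ , x) ∈ vars πγ → ∀ b → Eval α′ (var (ren x)) b → Eval α″ (var x) b
        original {τ} x x∈πγ b e with Eval-var⁻ e | vars-πγ x∈πγ
        ... | q , refl | inj₁ x∈zs′ = Eval-var⁺ x q (sym (override-∈ x∈zs′))
        ... | q , refl | inj₂ (x∈s , _) rewrite ren-∉ {x = x} (λ x∈zs′ → zs′∉s x∈zs′ x∈s) =
          Eval-var⁺ x q (trans (α′-agrees x q x∉xsA) (sym (override-∉ (λ x∈zs′ → zs′∉s x∈zs′ x∈s))))
          where
            x∉xsA : (τ , x) ∉ xsA
            x∉xsA x∈ with ∈-++⁻ xs₀ x∈
            ... | inj₁ x∈xs₀ = xs₀∉s _ x∈xs₀ x∈s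
            ... | inj₂ x∈copy = copy-fresh x∈copy (avoid-s x∈s)

    stepCore-A : SatECT A → StepCore A ρ′ p γ B
    stepCore-A sat = record
      { satisfiable = sat
      ; leftLinear = C.leftLinear
      ; disjoint = C.disjoint
      ; disjoint' = disjoint-conA
      ; dom = C.dom
      ; replace = C.replace
      ; valOrX = C.valOrX
      ; conB = refl
      ; boundB = λ v → ∈-∖⁻ (vars conB) , λ (v∈ , v∉) → ∈-∖⁺ v∈ v∉
      ; XB = C.XB
      }
      where
        disjoint-conA : ∀ v → VarRule ρ′ v → v ∈ vars conA → ⊥
        disjoint-conA v v∈ρ′ v∈ with vars-∧⁻ φ πγ′ v∈
        ... | inj₁ v∈φ = C.disjoint' v v∈ρ′ v∈φ
        ... | inj₂ v∈πγ′ with vars-πγ′ v∈πγ′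
        ...   | inj₁ v∈copy = copy-fresh v∈copy (avoid-ρ′ v∈ρ′)
        ...   | inj₂ (v∈s , _) = C.disjoint v v∈ρ′ v∈s

theorem3p7 : (S : Setting) → let open Theory S in
    ∀ {σ} (A₀ B₀ : ECT σ) (ρ : Rule) →
    IsECT A₀ → IsECT B₀ → WfRule ρ → LeftLinear ρ →
    A₀ ⇝[ ρ ] B₀ →
    Σ (ECT σ) λ A → Σ (ECT σ) λ B →
    IsECT A × IsECT B × (A ≾ A₀) × (A →[ ρ ] B) × (B ∼ B₀)
theorem3p7 S A₀ B₀ ρ wf-A₀ wf-B₀ wf-ρ _ (r , r-injective , p , γ , step , partial-redex) =
  A , B , IsECT-A , IsECT-B , A≾A₀ ,
  (r , r-injective , p , γ , stepCore-A (satisfiable-A partial-redex) , guard-entailed) ,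
  (B≾B₀ , B₀≾B)
  where open Properties.PartialToMostGeneral S A₀ B₀ ρ wf-A₀ wf-B₀ wf-ρ r p γ step
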